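{- If $G$ is a finite simple graph that contains no wheel as an induced subgraph and contains a diamond as an induced subgraph, then $G$ has a clique cutset.
   Context: A diamond is $K_4$ minus an edge. A hole is a chordless cycle of length at least 4; a wheel is a hole $H$ together with a node $c\notin V(H)$ with at least three neighbors in $H$. A clique cutset is a set $S$ of nodes inducing a clique (possibly empty) such that $G\setminus S$ is disconnected. -}

module Defs where

open import Data.Nat using (ℕ; suc; _≤_)
open import Data.Fin using (Fin; toℕ)
open import Data.Fin.Subset using (Subset; _∈_; _∉_)
open import Data.Bool using (Bool; true; false)
open import Data.Product using (Σ; ∃; ∃-syntax; _×_; _,_)
open import Data.Sum using (_⊎_)
open import Relation.Nullary using (¬_)
open import Relation.Binary.PropositionalEquality using (_≡_; _≢_)
open import Function.Definitions using (Injective)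

record Graph (n : ℕ) : Set where
  field
    adj    : Fin n → Fin n → Bool
    sym    : ∀ x y → adj x y ≡ adj y x
    irrefl : ∀ x → adj x x ≡ false

open Graph public

module _ {n : ℕ} (G : Graph n) where

  Adj : Fin n → Fin n → Set
  Adj x y = adj G x y ≡ true

  ContainsDiamond : Set
  ContainsDiamond =
    ∃[ a ] ∃[ b ] ∃[ c ] ∃[ d ]
      (a ≢ b × a ≢ c × a ≢ d × b ≢ c × b ≢ d × c ≢ d ×
       Adj a b × Adj a c × Adj a d × Adj b c × Adj b d × ¬ Adj c d)

  CycSucc : (k : ℕ) → Fin k → Fin k → Set
  CycSucc k i j = toℕ j ≡ suc (toℕ i) ⊎ (suc (toℕ i) ≡ k × toℕ j ≡ 0)

  CycAdj : (k : ℕ) → Fin k → Fin k → Set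
  CycAdj k i j = CycSucc k i j ⊎ CycSucc k j i

  IsHole : (k : ℕ) → (Fin k → Fin n) → Set
  IsHole k v = (4 ≤ k) × Injective _≡_ _≡_ v ×
               (∀ i j → (Adj (v i) (v j) → CycAdj k i j) × (CycAdj k i j → Adj (v i) (v j)))

  ContainsWheel : Set
  ContainsWheel =
    ∃[ k ] ∃[ v ] IsHole k v × ∃[ c ]
      ((∀ i → v i ≢ c) ×
       ∃[ i₁ ] ∃[ i₂ ] ∃[ i₃ ]
         (i₁ ≢ i₂ × i₁ ≢ i₃ × i₂ ≢ i₃ ×
          Adj c (v i₁) × Adj c (v i₂) × Adj c (v i₃)))

  data Reach (S : Subset n) : Fin n → Fin n → Set where
    here : ∀ {x} → x ∉ S → Reach S x x
    step : ∀ {x y z} → Reach S x y → Adj y z → z ∉ S → Reach S x z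

  IsClique : Subset n → Set
  IsClique S = ∀ x y → x ∈ S → y ∈ S → x ≢ y → Adj x y

  Disconnects : Subset n → Set
  Disconnects S = ∃[ u ] ∃[ w ] (u ∉ S × w ∉ S × ¬ Reach S u w)

  -- A clique cutset (possibly empty).
  HasCliqueCutset : Set
  HasCliqueCutset = ∃[ S ] (IsClique S × Disconnects S)

-- Let a, b, c, d span a diamond with c ≁ d, and let S₀ consist of a, b and their common
-- neighbours other than c and d. S₀ separates c from d: along an induced path from d to c
-- avoiding S₀, the first neighbours of a and of b must coincide in an interior vertex, as
-- otherwise a wheel appears, and that vertex would belong to S₀. Keeping only the
-- vertices of S₀ with a neighbour in the component of c, and then only those with a neighbour in
-- the component of d, yields a separator S ⊆ S₀ containing a and b. If s₁, s₂ ∈ S were distinct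
-- and non-adjacent, they would be common neighbours of a and b, joined by induced paths through
-- both components that together form a hole. Either a sees the interior of the path through the
-- component of c, and is the centre of a wheel on that hole, or a closes this path into a hole
-- on which b has the neighbours a, s₁ and s₂.

module Submission where

open import Defs renaming (sym to adj-sym)
open import Data.Nat as ℕ using (ℕ; zero; suc; _+_; _∸_; _≤_; _<_; z≤n; s≤s)
import Data.Nat.Properties as ℕ
open import Data.Fin using (Fin; toℕ; fromℕ<; _≟_)
open import Data.Fin.Properties using (any?; toℕ-injective; toℕ<n; toℕ-fromℕ<)
open import Data.Fin.Subset using (Subset; _∈_; _∉_; ∁; _-_; ∣_∣)
open import Data.Fin.Subset.Properties
  using (_∈?_; x∈p⇒x∉∁p; x∈∁p⇒x∉p; x∉∁p⇒x∈p; x∉p⇒x∈∁p; x∈p∧x≢y⇒x∈p-y; p─q⊆p; x∈p⇒∣p-x∣<∣p∣)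
open import Data.Vec using (tabulate)
open import Data.Vec.Properties using (lookup∘tabulate; []=⇒lookup; lookup⇒[]=)
open import Data.Bool using (true)
open import Data.Bool.Properties using () renaming (_≟_ to _≟ᵇ_)
open import Data.Product using (∃-syntax; _×_; _,_; proj₁; proj₂)
open import Data.Sum using (_⊎_; inj₁; inj₂)
open import Data.Empty using (⊥; ⊥-elim)
open import Relation.Nullary using (¬_; Dec; yes; no; does)
open import Relation.Nullary.Decidable using (_×-dec_; ¬?; _⊎-dec_; dec-true; decidable-stable)
open import Relation.Binary using (tri<; tri≈; tri>)
open import Relation.Binary.PropositionalEquality using (_≡_; _≢_; refl; sym; trans; cong; subst; subst₂)

module _ {n : ℕ} {P : Fin n → Set} (P? : ∀ x → Dec (P x)) where

  toSubset : Subset n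
  toSubset = tabulate (λ x → does (P? x))

  ∈-toSubset⁺ : ∀ {x} → P x → x ∈ toSubset
  ∈-toSubset⁺ {x} p = lookup⇒[]= x toSubset (trans (lookup∘tabulate _ x) (dec-true (P? x) p))

  ∈-toSubset⁻ : ∀ {x} → x ∈ toSubset → P x
  ∈-toSubset⁻ {x} x∈ with P? x | trans (sym (lookup∘tabulate _ x)) ([]=⇒lookup x∈)
  ... | yes p | _ = p
  ... | no _ | ()

module _ {P : ℕ → Set} (P? : ∀ k → Dec (P k)) where

  least≤ : ∀ m → (∀ k → k ≤ m → ¬ P k) ⊎ ∃[ i ] (i ≤ m × P i × (∀ k → k < i → ¬ P k))
  least≤ zero with P? 0
  ... | yes p = inj₂ (0 , z≤n , p , λ _ ())
  ... | no ¬p = inj₁ λ { zero _ → ¬p }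
  least≤ (suc m) with least≤ m
  ... | inj₂ (i , i≤m , p , below) = inj₂ (i , ℕ.m≤n⇒m≤1+n i≤m , p , below)
  ... | inj₁ none with P? (suc m)
  ...   | yes p = inj₂ (suc m , ℕ.≤-refl , p , λ k k<1+m → none k (ℕ.≤-pred k<1+m))
  ...   | no ¬p = inj₁ λ k k≤1+m → last k (ℕ.m≤n⇒m<n∨m≡n k≤1+m)
    where
    last : ∀ k → k < suc m ⊎ k ≡ suc m → ¬ P k
    last k (inj₁ k<1+m) = none k (ℕ.≤-pred k<1+m)
    last k (inj₂ refl) = ¬p

  greatest≤ : ∀ m → (∀ k → k ≤ m → ¬ P k) ⊎ ∃[ i ] (i ≤ m × P i × (∀ k → i < k → k ≤ m → ¬ P k))
  greatest≤ zero with P? 0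
  ... | yes p = inj₂ (0 , z≤n , p , λ k 0<k k≤0 → ⊥-elim (ℕ.<⇒≱ 0<k k≤0))
  ... | no ¬p = inj₁ λ { zero _ → ¬p }
  greatest≤ (suc m) with P? (suc m)
  ... | yes p = inj₂ (suc m , ℕ.≤-refl , p , λ k 1+m<k k≤1+m → ⊥-elim (ℕ.<⇒≱ 1+m<k k≤1+m))
  ... | no ¬p with greatest≤ m
  ...   | inj₁ none = inj₁ λ k k≤1+m → last k (ℕ.m≤n⇒m<n∨m≡n k≤1+m)
    where
    last : ∀ k → k < suc m ⊎ k ≡ suc m → ¬ P k
    last k (inj₁ k<1+m) = none k (ℕ.≤-pred k<1+m)
    last k (inj₂ refl) = ¬p
  ...   | inj₂ (i , i≤m , p , above) =
    inj₂ (i , ℕ.m≤n⇒m≤1+n i≤m , p , λ k i<k k≤1+m → last k i<k (ℕ.m≤n⇒m<n∨m≡n k≤1+m))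
    where
    last : ∀ k → i < k → k < suc m ⊎ k ≡ suc m → ¬ P k
    last k i<k (inj₁ k<1+m) = above k i<k (ℕ.≤-pred k<1+m)
    last k i<k (inj₂ refl) = ¬p

module Properties {n : ℕ} (G : Graph n) where

  _~_ : Fin n → Fin n → Set
  x ~ y = Adj G x y

  ~-sym : ∀ {x y} → x ~ y → y ~ x
  ~-sym {x} {y} x~y = trans (adj-sym G y x) x~y

  ~-irrefl : ∀ {x} → ¬ x ~ x
  ~-irrefl {x} x~x with trans (sym x~x) (irrefl G x)
  ... | ()

  ~⇒≢ : ∀ {x y} → x ~ y → x ≢ y
  ~⇒≢ x~y refl = ~-irrefl x~y

  _~?_ : ∀ x y → Dec (x ~ y)
  x ~? y = adj G x y ≟ᵇ true

  reach-start∉ : ∀ {S x y} → Reach G S x y → x ∉ S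
  reach-start∉ (here x∉S) = x∉S
  reach-start∉ (step r _ _) = reach-start∉ r

  reach-end∉ : ∀ {S x y} → Reach G S x y → y ∉ S
  reach-end∉ (here y∉S) = y∉S
  reach-end∉ (step _ _ y∉S) = y∉S

  reach-weaken : ∀ {S T x y} → (∀ v → v ∉ S → v ∉ T) → Reach G S x y → Reach G T x y
  reach-weaken S⊇T (here x∉S) = here (S⊇T _ x∉S)
  reach-weaken S⊇T (step r e z∉S) = step (reach-weaken S⊇T r) e (S⊇T _ z∉S)

  reach-cons : ∀ {S x y z} → x ∉ S → x ~ y → Reach G S y z → Reach G S x z
  reach-cons x∉S e (here z∉S) = step (here x∉S) e z∉S
  reach-cons x∉S e (step r e′ z∉S) = step (reach-cons x∉S e r) e′ z∉S

  reach-sym : ∀ {S x y} → Reach G S x y → Reach G S y x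
  reach-sym (here x∉S) = here x∉S
  reach-sym (step r e z∉S) = reach-cons z∉S (~-sym e) (reach-sym r)

  reach-trans : ∀ {S x y z} → Reach G S x y → Reach G S y z → Reach G S x z
  reach-trans r (here _) = r
  reach-trans r (step r′ e z∉S) = step (reach-trans r r′) e z∉S

  reach-confined : ∀ {S T x y} → (∀ v → Reach G S x v → v ∉ T) → Reach G S x y → Reach G T x y
  reach-confined conf (here x∉S) = here (conf _ (here x∉S))
  reach-confined conf (step r e z∉S) = step (reach-confined conf r) e (conf _ (step r e z∉S))

  reach-exit : ∀ {S T x z} → Reach G T x z → x ∉ S →
               Reach G S x z ⊎ ∃[ y ] ∃[ w ] (Reach G S x y × y ~ w × w ∈ S × w ∉ T)
  reach-exit (here _) x∉S = inj₁ (here x∉S)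
  reach-exit {S} (step {z = z} r e z∉T) x∉S with reach-exit r x∉S
  ... | inj₂ exit = inj₂ exit
  ... | inj₁ r′ with z ∈? S
  ...   | yes z∈S = inj₂ (_ , z , r′ , e , z∈S , z∉T)
  ...   | no z∉S = inj₁ (step r′ e z∉S)

  reach-first-step : ∀ {S T x z} → (∀ v → v ∉ S → v ≢ x → v ∉ T) → Reach G S x z → x ≢ z →
                     ∃[ y ] (x ~ y × Reach G T y z)
  reach-first-step S⊇T (here _) x≢z = ⊥-elim (x≢z refl)
  reach-first-step {x = x} S⊇T (step {y = w} {z = z} r e z∉S) x≢z with w ≟ x
  ... | yes refl = z , e , here (S⊇T z z∉S (λ z≡x → x≢z (sym z≡x)))
  ... | no w≢x with reach-first-step S⊇T r (λ x≡w → w≢x (sym x≡w))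
  ...   | y , x~y , r′ = y , x~y , step r′ e (S⊇T z z∉S (λ z≡x → x≢z (sym z≡x)))

  -- Recursion on the number of vertices a walk may still use, which drops by one at each step.
  reach-within? : ∀ k (A : Subset n) → ∣ A ∣ ≤ k → ∀ x z → Dec (Reach G (∁ A) x z)
  reach-within? k A ∣A∣≤k x z with x ∈? A
  ... | no x∉A = no λ r → x∉A (x∉∁p⇒x∈p (reach-start∉ r))
  ... | yes x∈A with x ≟ z
  ...   | yes refl = yes (here (x∈p⇒x∉∁p x∈A))
  ...   | no x≢z with k
  ...     | zero = ⊥-elim (ℕ.<⇒≱ (x∈p⇒∣p-x∣<∣p∣ x∈A) (ℕ.≤-trans ∣A∣≤k z≤n))
  ...     | suc k′
    with any? (λ y → x ~? y ×-dec reach-within? k′ (A - x) (ℕ.≤-pred (ℕ.≤-trans (x∈p⇒∣p-x∣<∣p∣ x∈A) ∣A∣≤k)) y z)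
  ...       | yes (y , x~y , r) =
    yes (reach-cons (x∈p⇒x∉∁p x∈A) x~y (reach-weaken (λ v v∉ → x∈p⇒x∉∁p (p─q⊆p A _ (x∉∁p⇒x∈p v∉))) r))
  ...       | no ¬step =
    no λ r → ¬step (reach-first-step (λ v v∉ v≢x → x∈p⇒x∉∁p (x∈p∧x≢y⇒x∈p-y (x∉∁p⇒x∈p v∉) v≢x)) r x≢z)

  reach? : ∀ S x z → Dec (Reach G S x z)
  reach? S x z with reach-within? ∣ ∁ S ∣ (∁ S) ℕ.≤-refl x z
  ... | yes r = yes (reach-weaken (λ v v∉ → x∈∁p⇒x∉p (x∉∁p⇒x∈p v∉)) r)
  ... | no ¬r = no λ r → ¬r (reach-weaken (λ v v∉ → x∈p⇒x∉∁p (x∉p⇒x∈∁p v∉)) r)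

  Consecutive : ℕ → ℕ → Set
  Consecutive i j = suc i ≡ j ⊎ suc j ≡ i

  -- A path is a function from ℕ of which only the values at 0 … m are relevant.
  record InducedPath (f : ℕ → Fin n) (m : ℕ) : Set where
    field
      injective : ∀ {i j} → i ≤ m → j ≤ m → f i ≡ f j → i ≡ j
      chordless : ∀ {i j} → i ≤ m → j ≤ m → f i ~ f j → Consecutive i j
      linked    : ∀ {i} → i < m → f i ~ f (suc i)

  open InducedPath public

  _◃_ : Fin n → (ℕ → Fin n) → ℕ → Fin n
  (w ◃ f) zero = w
  (w ◃ f) (suc k) = f k

  ◃-induced : ∀ {f m w} → InducedPath f m → (∀ k → k ≤ m → w ≢ f k) → w ~ f 0 →
              (∀ k → 1 ≤ k → k ≤ m → ¬ w ~ f k) → InducedPath (w ◃ f) (suc m)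
  injective (◃-induced P new _ _) {zero} {zero} _ _ _ = refl
  injective (◃-induced P new _ _) {zero} {suc j} _ j≤ eq = ⊥-elim (new j (ℕ.≤-pred j≤) eq)
  injective (◃-induced P new _ _) {suc i} {zero} i≤ _ eq = ⊥-elim (new i (ℕ.≤-pred i≤) (sym eq))
  injective (◃-induced P new _ _) {suc i} {suc j} i≤ j≤ eq =
    cong suc (injective P (ℕ.≤-pred i≤) (ℕ.≤-pred j≤) eq)
  chordless (◃-induced P _ _ far) {zero} {zero} _ _ e = ⊥-elim (~-irrefl e)
  chordless (◃-induced P _ _ far) {zero} {suc zero} _ _ _ = inj₁ refl
  chordless (◃-induced P _ _ far) {zero} {suc (suc j)} _ j≤ e = ⊥-elim (far (suc j) (s≤s z≤n) (ℕ.≤-pred j≤) e)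
  chordless (◃-induced P _ _ far) {suc zero} {zero} _ _ _ = inj₂ refl
  chordless (◃-induced P _ _ far) {suc (suc i)} {zero} i≤ _ e =
    ⊥-elim (far (suc i) (s≤s z≤n) (ℕ.≤-pred i≤) (~-sym e))
  chordless (◃-induced P _ _ far) {suc i} {suc j} i≤ j≤ e with chordless P (ℕ.≤-pred i≤) (ℕ.≤-pred j≤) e
  ... | inj₁ eq = inj₁ (cong suc eq)
  ... | inj₂ eq = inj₂ (cong suc eq)
  linked (◃-induced P _ w~f₀ _) {zero} _ = w~f₀
  linked (◃-induced P _ _ _) {suc i} i< = linked P (ℕ.≤-pred i<)

  induced-prefix : ∀ {f m j} → InducedPath f m → j ≤ m → InducedPath f j
  injective (induced-prefix P j≤m) i≤ k≤ = injective P (ℕ.≤-trans i≤ j≤m) (ℕ.≤-trans k≤ j≤m)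
  chordless (induced-prefix P j≤m) i≤ k≤ = chordless P (ℕ.≤-trans i≤ j≤m) (ℕ.≤-trans k≤ j≤m)
  linked (induced-prefix P j≤m) i< = linked P (ℕ.<-≤-trans i< j≤m)

  induced-tail : ∀ {f m} → InducedPath f (suc m) → InducedPath (λ k → f (suc k)) m
  injective (induced-tail P) i≤ j≤ eq = ℕ.suc-injective (injective P (s≤s i≤) (s≤s j≤) eq)
  chordless (induced-tail P) i≤ j≤ e with chordless P (s≤s i≤) (s≤s j≤) e
  ... | inj₁ eq = inj₁ (ℕ.suc-injective eq)
  ... | inj₂ eq = inj₂ (ℕ.suc-injective eq)
  linked (induced-tail P) i< = linked P (s≤s i<)

  induced-drop : ∀ {f} i m → InducedPath f (i + m) → InducedPath (λ k → f (i + k)) m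
  induced-drop zero m P = P
  induced-drop (suc i) m P = induced-drop i m (induced-tail P)

  ≤⊎≡+suc : ∀ m k → k ≤ m ⊎ ∃[ j ] (k ≡ m + suc j)
  ≤⊎≡+suc zero zero = inj₁ z≤n
  ≤⊎≡+suc zero (suc k) = inj₂ (k , refl)
  ≤⊎≡+suc (suc m) zero = inj₁ z≤n
  ≤⊎≡+suc (suc m) (suc k) with ≤⊎≡+suc m k
  ... | inj₁ k≤m = inj₁ (s≤s k≤m)
  ... | inj₂ (j , eq) = inj₂ (j , cong suc eq)

  -- append f m g runs along f 0 … f m and then along g 1, g 2, … (assuming f m ≡ g 0).
  append : (ℕ → Fin n) → ℕ → (ℕ → Fin n) → ℕ → Fin n
  append f zero g = g
  append f (suc m) g = f 0 ◃ append (λ k → f (suc k)) m g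

  append-left : ∀ f m g i → i ≤ m → f m ≡ g 0 → append f m g i ≡ f i
  append-left f zero g zero _ fm≡g₀ = sym fm≡g₀
  append-left f (suc m) g zero _ _ = refl
  append-left f (suc m) g (suc i) i≤ fm≡g₀ = append-left (λ k → f (suc k)) m g i (ℕ.≤-pred i≤) fm≡g₀

  append-right : ∀ f m g j → append f m g (m + j) ≡ g j
  append-right f zero g j = refl
  append-right f (suc m) g j = append-right (λ k → f (suc k)) m g j

  append-induced : ∀ f m g t → InducedPath f m → InducedPath g t → f m ≡ g 0 →
                   (∀ i j → i < m → 1 ≤ j → j ≤ t → f i ≢ g j × ¬ f i ~ g j) →
                   InducedPath (append f m g) (m + t)
  append-induced f zero g t _ Q _ _ = Q
  append-induced f (suc m) g t P Q fm≡g₀ apart =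
    ◃-induced (append-induced f′ m g t (induced-tail P) Q fm≡g₀ (λ i j i< → apart (suc i) j (s≤s i<)))
              new f₀~ far
    where
    f′ : ℕ → Fin n
    f′ k = f (suc k)
    new : ∀ k → k ≤ m + t → f 0 ≢ append f′ m g k
    new k k≤ with ≤⊎≡+suc m k
    ... | inj₁ k≤m rewrite append-left f′ m g k k≤m fm≡g₀ = λ eq → ℕ.0≢1+n (injective P z≤n (s≤s k≤m) eq)
    ... | inj₂ (j , refl) rewrite append-right f′ m g (suc j) =
      proj₁ (apart 0 (suc j) (s≤s z≤n) (s≤s z≤n) (ℕ.+-cancelˡ-≤ m _ _ k≤))
    f₀~ : f 0 ~ append f′ m g 0
    f₀~ rewrite append-left f′ m g 0 z≤n fm≡g₀ = linked P (s≤s z≤n)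
    far : ∀ k → 1 ≤ k → k ≤ m + t → ¬ f 0 ~ append f′ m g k
    far k 1≤k k≤ with ≤⊎≡+suc m k
    ... | inj₁ k≤m rewrite append-left f′ m g k k≤m fm≡g₀ = λ e → not-consecutive 1≤k (chordless P z≤n (s≤s k≤m) e)
      where
      not-consecutive : 1 ≤ k → ¬ Consecutive 0 (suc k)
      not-consecutive () (inj₁ refl)
      not-consecutive _ (inj₂ ())
    ... | inj₂ (j , refl) rewrite append-right f′ m g (suc j) =
      proj₂ (apart 0 (suc j) (s≤s z≤n) (s≤s z≤n) (ℕ.+-cancelˡ-≤ m _ _ k≤))

  record InducedPathAvoiding (S : Subset n) (u v : Fin n) : Set where
    constructor path
    field
      len     : ℕ
      vertex  : ℕ → Fin n
      induced : InducedPath vertex len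
      starts  : vertex 0 ≡ u
      ends    : vertex len ≡ v
      avoids  : ∀ k → k ≤ len → vertex k ∉ S

  trivial-path : ∀ {S x} → x ∉ S → InducedPathAvoiding S x x
  trivial-path {x = x} x∉S = path 0 (λ _ → x) single refl refl (λ _ _ → x∉S)
    where
    single : InducedPath (λ _ → x) 0
    injective single {zero} {zero} _ _ _ = refl
    chordless single _ _ e = ⊥-elim (~-irrefl e)
    linked single ()

  -- Prepend z and cut out the loop back to the last vertex of the path that z sees.
  shortcut : ∀ {S y x z} → InducedPathAvoiding S y x → y ~ z → z ∉ S → InducedPathAvoiding S z x
  shortcut {S} {x = x} {z} (path m f P f₀≡y fm≡x avoids) y~z z∉S
    with greatest≤ (λ k → z ~? f k ⊎-dec z ≟ f k) m
  ... | inj₁ none = ⊥-elim (none 0 z≤n (inj₁ (subst (z ~_) (sym f₀≡y) (~-sym y~z))))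
  ... | inj₂ (i , i≤m , seen , unseen) = from-last seen
    where
    i+[m∸i]≡m : i + (m ∸ i) ≡ m
    i+[m∸i]≡m = ℕ.m+[n∸m]≡n i≤m
    g : ℕ → Fin n
    g k = f (i + k)
    Q : InducedPath g (m ∸ i)
    Q = induced-drop i (m ∸ i) (subst (InducedPath f) (sym i+[m∸i]≡m) P)
    in-range : ∀ k → k ≤ m ∸ i → i + k ≤ m
    in-range k k≤ = subst (i + k ≤_) i+[m∸i]≡m (ℕ.+-monoʳ-≤ i k≤)
    g₀≡fi : g 0 ≡ f i
    g₀≡fi = cong f (ℕ.+-identityʳ i)
    g-ends : g (m ∸ i) ≡ x
    g-ends = trans (cong f i+[m∸i]≡m) fm≡x
    g-avoids : ∀ k → k ≤ m ∸ i → g k ∉ S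
    g-avoids k k≤ = avoids (i + k) (in-range k k≤)
    beyond : ∀ k → i < i + suc k
    beyond k = subst (i <_) (sym (ℕ.+-suc i k)) (ℕ.m≤m+n (suc i) k)
    from-last : z ~ f i ⊎ z ≡ f i → InducedPathAvoiding S z x
    from-last (inj₂ z≡fi) = path (m ∸ i) g Q (trans g₀≡fi (sym z≡fi)) g-ends g-avoids
    from-last (inj₁ z~fi) = path (suc (m ∸ i)) (z ◃ g) (◃-induced Q new z~g₀ far) refl g-ends avoids′
      where
      new : ∀ k → k ≤ m ∸ i → z ≢ g k
      new zero _ z≡g₀ = ~-irrefl (subst (z ~_) (sym (trans z≡g₀ g₀≡fi)) z~fi)
      new (suc k) k≤ z≡ = unseen (i + suc k) (beyond k) (in-range (suc k) k≤) (inj₂ z≡)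
      z~g₀ : z ~ g 0
      z~g₀ = subst (z ~_) (sym g₀≡fi) z~fi
      far : ∀ k → 1 ≤ k → k ≤ m ∸ i → ¬ z ~ g k
      far (suc k) _ k≤ z~ = unseen (i + suc k) (beyond k) (in-range (suc k) k≤) (inj₁ z~)
      avoids′ : ∀ k → k ≤ suc (m ∸ i) → (z ◃ g) k ∉ S
      avoids′ zero _ = z∉S
      avoids′ (suc k) k≤ = g-avoids k (ℕ.≤-pred k≤)

  induced-path : ∀ {S x z} → Reach G S x z → InducedPathAvoiding S z x
  induced-path (here x∉S) = trivial-path x∉S
  induced-path (step r y~z z∉S) = shortcut (induced-path r) y~z z∉S

  endpoint-or-interior : ∀ k m → k ≤ m → k ≡ 0 ⊎ k ≡ m ⊎ (1 ≤ k × k < m)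
  endpoint-or-interior zero m _ = inj₁ refl
  endpoint-or-interior (suc k) m k≤m with ℕ.m≤n⇒m<n∨m≡n k≤m
  ... | inj₁ k<m = inj₂ (inj₂ (s≤s z≤n , k<m))
  ... | inj₂ k≡m = inj₂ (inj₁ k≡m)

  length≥2 : ∀ {f m x z} → InducedPath f m → f 0 ≡ z → f m ≡ x → x ≢ z → ¬ x ~ z → 2 ≤ m
  length≥2 {m = zero} _ f₀≡z fm≡x x≢z _ = ⊥-elim (x≢z (trans (sym fm≡x) f₀≡z))
  length≥2 {m = suc zero} P f₀≡z fm≡x _ x≁z = ⊥-elim (x≁z (~-sym (subst₂ _~_ f₀≡z fm≡x (linked P (s≤s z≤n)))))
  length≥2 {m = suc (suc _)} _ _ _ _ _ = s≤s (s≤s z≤n)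

  -- CycAdj of Defs, read off on indices in ℕ.
  CyclicNeighbours : ℕ → ℕ → ℕ → Set
  CyclicNeighbours k i j = (j ≡ suc i ⊎ (suc i ≡ k × j ≡ 0)) ⊎ (i ≡ suc j ⊎ (suc j ≡ k × i ≡ 0))

  module Closing {f : ℕ → Fin n} {m : ℕ} {w : Fin n} (P : InducedPath f m) (2≤m : 2 ≤ m)
                 (w-new : ∀ k → k ≤ m → w ≢ f k) (w~f₀ : w ~ f 0) (w~fm : w ~ f m)
                 (w-far : ∀ k → 1 ≤ k → k < m → ¬ w ~ f k) where

    cycle-adjacency : ∀ i j → i ≤ suc m → j ≤ suc m →
                      ((w ◃ f) i ~ (w ◃ f) j → CyclicNeighbours (suc (suc m)) i j) ×
                      (CyclicNeighbours (suc (suc m)) i j → (w ◃ f) i ~ (w ◃ f) j)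
    cycle-adjacency zero zero _ _ = (λ e → ⊥-elim (~-irrefl e)) ,
      λ { (inj₁ (inj₁ ())) ; (inj₁ (inj₂ (() , _))) ; (inj₂ (inj₁ ())) ; (inj₂ (inj₂ (() , _))) }
    cycle-adjacency zero (suc j) _ j≤ = to (endpoint-or-interior j m (ℕ.≤-pred j≤)) , from
      where
      to : j ≡ 0 ⊎ j ≡ m ⊎ (1 ≤ j × j < m) → w ~ f j → CyclicNeighbours (suc (suc m)) 0 (suc j)
      to (inj₁ refl) _ = inj₁ (inj₁ refl)
      to (inj₂ (inj₁ refl)) _ = inj₂ (inj₂ (refl , refl))
      to (inj₂ (inj₂ (1≤j , j<m))) e = ⊥-elim (w-far j 1≤j j<m e)
      from : CyclicNeighbours (suc (suc m)) 0 (suc j) → w ~ f j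
      from (inj₁ (inj₁ refl)) = w~f₀
      from (inj₁ (inj₂ (() , _)))
      from (inj₂ (inj₁ ()))
      from (inj₂ (inj₂ (refl , _))) = w~fm
    cycle-adjacency (suc i) zero i≤ _ = to (endpoint-or-interior i m (ℕ.≤-pred i≤)) , from
      where
      to : i ≡ 0 ⊎ i ≡ m ⊎ (1 ≤ i × i < m) → f i ~ w → CyclicNeighbours (suc (suc m)) (suc i) 0
      to (inj₁ refl) _ = inj₂ (inj₁ refl)
      to (inj₂ (inj₁ refl)) _ = inj₁ (inj₂ (refl , refl))
      to (inj₂ (inj₂ (1≤i , i<m))) e = ⊥-elim (w-far i 1≤i i<m (~-sym e))
      from : CyclicNeighbours (suc (suc m)) (suc i) 0 → f i ~ w
      from (inj₁ (inj₁ ()))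
      from (inj₁ (inj₂ (refl , _))) = ~-sym w~fm
      from (inj₂ (inj₁ refl)) = ~-sym w~f₀
      from (inj₂ (inj₂ (_ , ())))
    cycle-adjacency (suc i) (suc j) i≤ j≤ = to , from
      where
      to : f i ~ f j → CyclicNeighbours (suc (suc m)) (suc i) (suc j)
      to e with chordless P (ℕ.≤-pred i≤) (ℕ.≤-pred j≤) e
      ... | inj₁ eq = inj₁ (inj₁ (cong suc (sym eq)))
      ... | inj₂ eq = inj₂ (inj₁ (cong suc (sym eq)))
      from : CyclicNeighbours (suc (suc m)) (suc i) (suc j) → f i ~ f j
      from (inj₁ (inj₁ refl)) = linked P (ℕ.≤-pred j≤)
      from (inj₁ (inj₂ (_ , ())))
      from (inj₂ (inj₁ refl)) = ~-sym (linked P (ℕ.≤-pred i≤))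
      from (inj₂ (inj₂ (_ , ())))

    cycle-injective : ∀ i j → i ≤ suc m → j ≤ suc m → (w ◃ f) i ≡ (w ◃ f) j → i ≡ j
    cycle-injective zero zero _ _ _ = refl
    cycle-injective zero (suc j) _ j≤ eq = ⊥-elim (w-new j (ℕ.≤-pred j≤) eq)
    cycle-injective (suc i) zero i≤ _ eq = ⊥-elim (w-new i (ℕ.≤-pred i≤) (sym eq))
    cycle-injective (suc i) (suc j) i≤ j≤ eq = cong suc (injective P (ℕ.≤-pred i≤) (ℕ.≤-pred j≤) eq)

    cycle : Fin (suc (suc m)) → Fin n
    cycle i = (w ◃ f) (toℕ i)

    toℕ≤ : ∀ (i : Fin (suc (suc m))) → toℕ i ≤ suc m
    toℕ≤ i = ℕ.≤-pred (toℕ<n i)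

    hole : IsHole G (suc (suc m)) cycle
    hole = s≤s (s≤s 2≤m) ,
           (λ {i} {j} eq → toℕ-injective (cycle-injective (toℕ i) (toℕ j) (toℕ≤ i) (toℕ≤ j) eq)) ,
           λ i j → cycle-adjacency (toℕ i) (toℕ j) (toℕ≤ i) (toℕ≤ j)

    wheel : (c : Fin n) → c ≢ w → (∀ k → k ≤ m → c ≢ f k) →
            (i₁ i₂ i₃ : ℕ) → i₁ ≤ suc m → i₂ ≤ suc m → i₃ ≤ suc m → i₁ ≢ i₂ → i₁ ≢ i₃ → i₂ ≢ i₃ →
            c ~ (w ◃ f) i₁ → c ~ (w ◃ f) i₂ → c ~ (w ◃ f) i₃ → ContainsWheel G
    wheel c c≢w c-new i₁ i₂ i₃ i₁≤ i₂≤ i₃≤ i₁≢i₂ i₁≢i₃ i₂≢i₃ c~₁ c~₂ c~₃ =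
      suc (suc m) , cycle , hole , c , off-cycle ,
      fromℕ< (s≤s i₁≤) , fromℕ< (s≤s i₂≤) , fromℕ< (s≤s i₃≤) ,
      fromℕ<-≢ (s≤s i₁≤) (s≤s i₂≤) i₁≢i₂ , fromℕ<-≢ (s≤s i₁≤) (s≤s i₃≤) i₁≢i₃ , fromℕ<-≢ (s≤s i₂≤) (s≤s i₃≤) i₂≢i₃ ,
      at-fromℕ< (s≤s i₁≤) c~₁ , at-fromℕ< (s≤s i₂≤) c~₂ , at-fromℕ< (s≤s i₃≤) c~₃
      where
      off-cycle : ∀ i → cycle i ≢ c
      off-cycle i eq with toℕ i | toℕ≤ i
      ... | zero | _ = c≢w (sym eq)
      ... | suc k | k≤ = c-new k (ℕ.≤-pred k≤) (sym eq)
      fromℕ<-≢ : ∀ {i j} (p : i < suc (suc m)) (q : j < suc (suc m)) → i ≢ j → fromℕ< p ≢ fromℕ< q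
      fromℕ<-≢ p q i≢j eq = i≢j (trans (sym (toℕ-fromℕ< p)) (trans (cong toℕ eq) (toℕ-fromℕ< q)))
      at-fromℕ< : ∀ {i} (p : i < suc (suc m)) → c ~ (w ◃ f) i → c ~ cycle (fromℕ< p)
      at-fromℕ< p c~ = subst (λ k → c ~ (w ◃ f) k) (sym (toℕ-fromℕ< p)) c~

  -- w closes the initial segment f 0 … f j into a hole, and c sees w, f 0 and f i.
  fan-wheel : ∀ {f m} → InducedPath f m → (w c : Fin n) → w ~ c →
              (∀ k → k ≤ m → f k ≢ w) → (∀ k → k ≤ m → f k ≢ c) → w ~ f 0 → c ~ f 0 →
              (j : ℕ) → 2 ≤ j → j ≤ m → w ~ f j → (∀ k → 1 ≤ k → k < j → ¬ w ~ f k) →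
              (i : ℕ) → 1 ≤ i → i ≤ j → c ~ f i → ContainsWheel G
  fan-wheel P w c w~c f≢w f≢c w~f₀ c~f₀ j 2≤j j≤m w~fj w-far i 1≤i i≤j c~fi =
    Closing.wheel (induced-prefix P j≤m) 2≤j (λ k k≤ eq → f≢w k (ℕ.≤-trans k≤ j≤m) (sym eq)) w~f₀ w~fj w-far
      c (λ eq → ~⇒≢ w~c (sym eq)) (λ k k≤ eq → f≢c k (ℕ.≤-trans k≤ j≤m) (sym eq))
      0 1 (suc i) z≤n (s≤s z≤n) (s≤s i≤j) (λ ()) (λ ())
      (λ 1≡1+i → ℕ.n>0⇒n≢0 1≤i (sym (ℕ.suc-injective 1≡1+i))) (~-sym w~c) c~f₀ c~fi

  first-neighbour : ∀ {m} (f : ℕ → Fin n) x → 1 ≤ m → x ~ f m →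
                    ∃[ j ] (j ≤ m × 1 ≤ j × x ~ f j × (∀ k → 1 ≤ k → k < j → ¬ x ~ f k))
  first-neighbour {m} f x 1≤m x~fm with least≤ (λ k → (1 ℕ.≤? k) ×-dec x ~? f k) m
  ... | inj₁ none = ⊥-elim (none m ℕ.≤-refl (1≤m , x~fm))
  ... | inj₂ (j , j≤m , (1≤j , x~fj) , before) = j , j≤m , 1≤j , x~fj , λ k 1≤k k<j e → before k k<j (1≤k , e)

  -- Compare the first neighbours of a and b along P: if they differ, the later one closes a hole
  -- and the other one is the centre of a wheel.
  common-interior-neighbour : ∀ {f m a b} → InducedPath f m → 2 ≤ m → a ~ b →
                              (∀ k → k ≤ m → f k ≢ a) → (∀ k → k ≤ m → f k ≢ b) →
                              a ~ f 0 → b ~ f 0 → a ~ f m → b ~ f m →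
                              ContainsWheel G ⊎ ∃[ j ] (1 ≤ j × j < m × a ~ f j × b ~ f j)
  common-interior-neighbour {f} {m} {a} {b} P 2≤m a~b f≢a f≢b a~f₀ b~f₀ a~fm b~fm
    with first-neighbour f a 1≤m a~fm | first-neighbour f b 1≤m b~fm
    where
    1≤m : 1 ≤ m
    1≤m = ℕ.≤-trans (s≤s z≤n) 2≤m
  ... | i , i≤m , 1≤i , a~fi , a-far | j , j≤m , 1≤j , b~fj , b-far with ℕ.<-cmp i j
  ...   | tri< i<j _ _ = inj₁ (fan-wheel P b a (~-sym a~b) f≢b f≢a b~f₀ a~f₀
                                 j (ℕ.≤-trans (s≤s 1≤i) i<j) j≤m b~fj b-far i 1≤i (ℕ.<⇒≤ i<j) a~fi)
  ...   | tri> _ _ j<i = inj₁ (fan-wheel P a b a~b f≢a f≢b a~f₀ b~f₀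
                                 i (ℕ.≤-trans (s≤s 1≤j) j<i) i≤m a~fi a-far j 1≤j (ℕ.<⇒≤ j<i) b~fj)
  ...   | tri≈ _ refl _ with ℕ.m≤n⇒m<n∨m≡n i≤m
  ...     | inj₁ i<m = inj₂ (i , 1≤i , i<m , a~fi , b~fj)
  ...     | inj₂ refl = inj₁ (fan-wheel P a b a~b f≢a f≢b a~f₀ b~f₀ i 2≤m ℕ.≤-refl a~fi a-far i 1≤i ℕ.≤-refl b~fj)

  Attached : Subset n → Fin n → Fin n → Set
  Attached S x w = ∃[ y ] (w ~ y × Reach G S x y)

  attached? : ∀ S x w → Dec (Attached S x w)
  attached? S x w = any? (λ y → w ~? y ×-dec reach? S x y)

  attached-weaken : ∀ {S T x w} → (∀ v → v ∉ S → v ∉ T) → Attached S x w → Attached T x w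
  attached-weaken S⊇T (y , w~y , r) = y , w~y , reach-weaken S⊇T r

  refine : Subset n → Fin n → Subset n
  refine S x = toSubset (λ w → w ∈? S ×-dec attached? S x w)

  ∈-refine⁺ : ∀ {S x w} → w ∈ S → Attached S x w → w ∈ refine S x
  ∈-refine⁺ {S} {x} w∈S att = ∈-toSubset⁺ (λ w → w ∈? S ×-dec attached? S x w) (w∈S , att)

  refine-⊆ : ∀ {S x w} → w ∈ refine S x → w ∈ S
  refine-⊆ {S} {x} w∈ = proj₁ (∈-toSubset⁻ (λ w → w ∈? S ×-dec attached? S x w) w∈)

  refine-attached : ∀ {S x w} → w ∈ refine S x → Attached S x w
  refine-attached {S} {x} w∈ = proj₂ (∈-toSubset⁻ (λ w → w ∈? S ×-dec attached? S x w) w∈)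

  -- A walk escaping refine S x must enter S at a vertex attached to the component of x.
  refine-separates : ∀ {S x z} → x ∉ S → ¬ Reach G S x z → ¬ Reach G (refine S x) x z
  refine-separates x∉S ¬r r with reach-exit r x∉S
  ... | inj₁ r′ = ¬r r′
  ... | inj₂ (y , w , r′ , y~w , w∈S , w∉) = w∉ (∈-refine⁺ w∈S (y , ~-sym y~w , r′))

  record InducedPathThrough (S : Subset n) (x u v : Fin n) : Set where
    constructor path-through
    field
      len      : ℕ
      vertex   : ℕ → Fin n
      induced  : InducedPath vertex len
      starts   : vertex 0 ≡ u
      ends     : vertex len ≡ v
      long     : 2 ≤ len
      interior : ∀ k → 1 ≤ k → k < len → Reach G S x (vertex k)

  -- Extracted from a walk inside {u, v} ∪ (component of x in G ∖ S).
  induced-path-through : ∀ {S x u v} → u ≢ v → ¬ u ~ v → Attached S x u → Attached S x v →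
                         InducedPathThrough S x u v
  induced-path-through {S} {x} {u} {v} u≢v u≁v (yᵤ , u~yᵤ , rᵤ) (yᵥ , v~yᵥ , rᵥ) =
    from-path (induced-path walk)
    where
    Region : Fin n → Set
    Region w = w ≡ u ⊎ w ≡ v ⊎ Reach G S x w
    region? : ∀ w → Dec (Region w)
    region? w = (w ≟ u) ⊎-dec (w ≟ v) ⊎-dec reach? S x w
    outside : Subset n
    outside = toSubset (λ w → ¬? (region? w))
    region-∉ : ∀ {w} → Region w → w ∉ outside
    region-∉ in-region w∈ = ∈-toSubset⁻ (λ w → ¬? (region? w)) w∈ in-region
    ∉-region : ∀ {w} → w ∉ outside → Region w
    ∉-region {w} w∉ = decidable-stable (region? w) (λ ¬in → w∉ (∈-toSubset⁺ (λ w → ¬? (region? w)) ¬in))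
    inside : ∀ {y} → Reach G S x y → Reach G outside x y
    inside = reach-confined (λ w r → region-∉ (inj₂ (inj₂ r)))
    walk : Reach G outside v u
    walk = step (reach-trans (reach-cons (region-∉ (inj₂ (inj₁ refl))) v~yᵥ (reach-sym (inside rᵥ))) (inside rᵤ))
                (~-sym u~yᵤ) (region-∉ (inj₁ refl))
    from-path : InducedPathAvoiding outside u v → InducedPathThrough S x u v
    from-path (path m f P f₀≡u fm≡v avoids) =
      path-through m f P f₀≡u fm≡v (length≥2 P f₀≡u fm≡v (λ eq → u≢v (sym eq)) (λ e → u≁v (~-sym e))) interior
      where
      interior′ : ∀ k → 1 ≤ k → k < m → Region (f k) → Reach G S x (f k)
      interior′ k 1≤k k<m (inj₁ fk≡u) =
        ⊥-elim (ℕ.n>0⇒n≢0 1≤k (injective P (ℕ.<⇒≤ k<m) z≤n (trans fk≡u (sym f₀≡u))))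
      interior′ k 1≤k k<m (inj₂ (inj₁ fk≡v)) =
        ⊥-elim (ℕ.<⇒≢ k<m (injective P (ℕ.<⇒≤ k<m) ℕ.≤-refl (trans fk≡v (sym fm≡v))))
      interior′ k 1≤k k<m (inj₂ (inj₂ r)) = r
      interior : ∀ k → 1 ≤ k → k < m → Reach G S x (f k)
      interior k 1≤k k<m = interior′ k 1≤k k<m (∉-region (avoids k (ℕ.<⇒≤ k<m)))

  open InducedPathThrough public using (len; vertex)

  through-avoids : ∀ {S x u v h} (P : InducedPathThrough S x u v) → h ∈ S → h ~ u → h ~ v →
                   ∀ k → k ≤ len P → vertex P k ≢ h
  through-avoids {S} {h = h} (path-through m f _ f₀≡u fm≡v _ interior) h∈S h~u h~v k k≤m =
    avoid (endpoint-or-interior k m k≤m)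
    where
    avoid : k ≡ 0 ⊎ k ≡ m ⊎ (1 ≤ k × k < m) → f k ≢ h
    avoid (inj₁ refl) eq = ~⇒≢ h~u (trans (sym eq) f₀≡u)
    avoid (inj₂ (inj₁ refl)) eq = ~⇒≢ h~v (trans (sym eq) fm≡v)
    avoid (inj₂ (inj₂ (1≤k , k<m))) eq = reach-end∉ (interior k 1≤k k<m) (subst (_∈ S) (sym eq) h∈S)

  -- The cycle s₁, f 1, …, f m = s₂ = g 0, g 1, …, g (t - 1) is induced: its two halves lie in
  -- different components of G ∖ S, so no edge joins their interiors.
  module Glued {S c d s₁ s₂} (separated : ¬ Reach G S c d) {m₁ t₁ : ℕ} {f g : ℕ → Fin n}
               (P : InducedPath f (suc m₁)) (f₀≡s₁ : f 0 ≡ s₁) (fm≡s₂ : f (suc m₁) ≡ s₂)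
               (f-interior : ∀ k → 1 ≤ k → k < suc m₁ → Reach G S c (f k))
               (Q : InducedPath g (suc t₁)) (g₀≡s₂ : g 0 ≡ s₂) (gt≡s₁ : g (suc t₁) ≡ s₁)
               (g-interior : ∀ k → 1 ≤ k → k < suc t₁ → Reach G S d (g k)) where

    f′ : ℕ → Fin n
    f′ k = f (suc k)

    joint : f′ m₁ ≡ g 0
    joint = trans fm≡s₂ (sym g₀≡s₂)

    glued : ℕ → Fin n
    glued = append f′ m₁ g

    glued-left : ∀ k → k ≤ m₁ → glued k ≡ f (suc k)
    glued-left k k≤ = append-left f′ m₁ g k k≤ joint

    glued-right : ∀ j → glued (m₁ + j) ≡ g j
    glued-right j = append-right f′ m₁ g j

    apart : ∀ i j → i < m₁ → 1 ≤ j → j ≤ t₁ → f′ i ≢ g j × ¬ f′ i ~ g j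
    apart i j i< 1≤j j≤ =
      (λ eq → separated (reach-trans (subst (Reach G S c) eq rᶜ) (reach-sym rᵈ))) ,
      (λ e → separated (reach-trans (step rᶜ e (reach-end∉ rᵈ)) (reach-sym rᵈ)))
      where
      rᶜ : Reach G S c (f′ i)
      rᶜ = f-interior (suc i) (s≤s z≤n) (s≤s i<)
      rᵈ : Reach G S d (g j)
      rᵈ = g-interior j 1≤j (s≤s j≤)

    glued-induced : InducedPath glued (m₁ + t₁)
    glued-induced = append-induced f′ m₁ g t₁ (induced-tail P) (induced-prefix Q (ℕ.n≤1+n t₁)) joint apart

    s₁-new : ∀ k → k ≤ m₁ + t₁ → s₁ ≢ glued k
    s₁-new k k≤ = new (≤⊎≡+suc m₁ k)
      where
      new : k ≤ m₁ ⊎ ∃[ j ] (k ≡ m₁ + suc j) → s₁ ≢ glued k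
      new (inj₁ k≤m₁) eq with injective P z≤n (s≤s k≤m₁) (trans f₀≡s₁ (trans eq (glued-left k k≤m₁)))
      ... | ()
      new (inj₂ (j , refl)) eq = ℕ.<-irrefl (sym (ℕ.suc-injective t≡j)) j<t₁
        where
        j<t₁ : j < t₁
        j<t₁ = ℕ.+-cancelˡ-≤ m₁ _ _ k≤
        t≡j : suc t₁ ≡ suc j
        t≡j = injective Q ℕ.≤-refl (ℕ.m≤n⇒m≤1+n j<t₁) (trans gt≡s₁ (trans eq (glued-right (suc j))))

    s₁~start : s₁ ~ glued 0
    s₁~start = subst (s₁ ~_) (sym (glued-left 0 z≤n)) (subst (_~ f 1) f₀≡s₁ (linked P (s≤s z≤n)))

    s₁~end : s₁ ~ glued (m₁ + t₁)
    s₁~end = subst (s₁ ~_) (sym (glued-right t₁)) (~-sym (subst (g t₁ ~_) gt≡s₁ (linked Q ℕ.≤-refl)))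

    s₁-far : ∀ k → 1 ≤ k → k < m₁ + t₁ → ¬ s₁ ~ glued k
    s₁-far k 1≤k k< = far (≤⊎≡+suc m₁ k)
      where
      far : k ≤ m₁ ⊎ ∃[ j ] (k ≡ m₁ + suc j) → ¬ s₁ ~ glued k
      far (inj₁ k≤m₁) e with chordless P z≤n (s≤s k≤m₁) (subst₂ _~_ (sym f₀≡s₁) (glued-left k k≤m₁) e)
      ... | inj₁ 1≡1+k = ℕ.n>0⇒n≢0 1≤k (ℕ.suc-injective (sym 1≡1+k))
      ... | inj₂ ()
      far (inj₂ (j , refl)) e with ℕ.+-cancelˡ-< m₁ (suc j) t₁ k<
      ... | 1+j<t₁
        with chordless Q ℕ.≤-refl (ℕ.m≤n⇒m≤1+n (ℕ.<⇒≤ 1+j<t₁)) (subst₂ _~_ (sym gt≡s₁) (glued-right (suc j)) e)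
      ...   | inj₁ 2+t₁≡1+j = ℕ.<-irrefl (sym 2+t₁≡1+j) (ℕ.m<n⇒m<1+n (ℕ.m<n⇒m<1+n 1+j<t₁))
      ...   | inj₂ 2+j≡1+t₁ = ℕ.<-irrefl (ℕ.suc-injective 2+j≡1+t₁) 1+j<t₁

  -- The rim of the wheel is the hole built in Glued.
  two-sided-wheel : ∀ {S c d s₁ s₂ h} → ¬ Reach G S c d →
                    (P : InducedPathThrough S c s₁ s₂) → InducedPathThrough S d s₂ s₁ →
                    h ∈ S → h ~ s₁ → h ~ s₂ →
                    ∀ k → 1 ≤ k → k < len P → h ~ vertex P k → ContainsWheel G
  two-sided-wheel {S} {c} {d} {s₁} {s₂} {h} separated
    P@(path-through (suc m₁) f Pᵢ f₀≡s₁ fm≡s₂ (s≤s 1≤m₁) f-interior)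
    (path-through (suc t₁) g Qᵢ g₀≡s₂ gt≡s₁ (s≤s 1≤t₁) g-interior)
    h∈S h~s₁ h~s₂ (suc k) _ k<m h~fk =
    Closing.wheel glued-induced (ℕ.+-mono-≤ 1≤m₁ 1≤t₁) s₁-new s₁~start s₁~end s₁-far h
      (~⇒≢ h~s₁) h-new 0 (suc k) (suc m₁)
      z≤n (s≤s (ℕ.≤-trans k≤m₁ (ℕ.m≤m+n m₁ t₁))) (s≤s (ℕ.m≤m+n m₁ t₁)) (λ ()) (λ ()) (ℕ.<⇒≢ k<m)
      h~s₁ (subst (h ~_) (sym (glued-left k k≤m₁)) h~fk)
      (subst (h ~_) (sym (trans (glued-left m₁ ℕ.≤-refl) fm≡s₂)) h~s₂)
    where
    open Glued separated Pᵢ f₀≡s₁ fm≡s₂ f-interior Qᵢ g₀≡s₂ gt≡s₁ g-interior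
    k≤m₁ : k ≤ m₁
    k≤m₁ = ℕ.<⇒≤ (ℕ.≤-pred k<m)
    h-new : ∀ j → j ≤ m₁ + t₁ → h ≢ glued j
    h-new j j≤ = new (≤⊎≡+suc m₁ j)
      where
      new : j ≤ m₁ ⊎ ∃[ i ] (j ≡ m₁ + suc i) → h ≢ glued j
      new (inj₁ j≤m₁) eq = through-avoids P h∈S h~s₁ h~s₂ (suc j) (s≤s j≤m₁) (sym (trans eq (glued-left j j≤m₁)))
      new (inj₂ (i , refl)) eq =
        reach-end∉ (g-interior (suc i) (s≤s z≤n) (s≤s (ℕ.+-cancelˡ-≤ m₁ _ _ j≤)))
                   (subst (_∈ S) (trans eq (glued-right (suc i))) h∈S)

  -- If a has no neighbour inside P, then a closes P into a hole on which b sees a, s₁ and s₂.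
  nonadjacent-pair-wheel : ∀ {S c d s₁ s₂ a b} → ¬ Reach G S c d → s₁ ≢ s₂ → ¬ s₁ ~ s₂ →
                           Attached S c s₁ → Attached S c s₂ → Attached S d s₁ → Attached S d s₂ →
                           a ∈ S → b ∈ S → a ~ b → a ~ s₁ → a ~ s₂ → b ~ s₁ → b ~ s₂ → ContainsWheel G
  nonadjacent-pair-wheel {S} {c} {d} {s₁} {s₂} {a} {b}
    separated s₁≢s₂ s₁≁s₂ c₁ c₂ d₁ d₂ a∈S b∈S a~b a~s₁ a~s₂ b~s₁ b~s₂
    with induced-path-through s₁≢s₂ s₁≁s₂ c₁ c₂
  ... | P@(path-through m f Pᵢ f₀≡s₁ fm≡s₂ 2≤m _)
    with least≤ (λ k → (1 ℕ.≤? k) ×-dec (k ℕ.<? m) ×-dec a ~? f k) m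
  ... | inj₂ (k , _ , (1≤k , k<m , a~fk) , _) =
    two-sided-wheel separated P Q a∈S a~s₁ a~s₂ k 1≤k k<m a~fk
    where
    Q : InducedPathThrough S d s₂ s₁
    Q = induced-path-through (λ eq → s₁≢s₂ (sym eq)) (λ e → s₁≁s₂ (~-sym e)) d₂ d₁
  ... | inj₁ none =
    fan-wheel Pᵢ a b a~b (through-avoids P a∈S a~s₁ a~s₂) (through-avoids P b∈S b~s₁ b~s₂)
      (subst (a ~_) (sym f₀≡s₁) a~s₁) (subst (b ~_) (sym f₀≡s₁) b~s₁)
      m 2≤m ℕ.≤-refl (subst (a ~_) (sym fm≡s₂) a~s₂) (λ k 1≤k k<m e → none k (ℕ.<⇒≤ k<m) (1≤k , k<m , e))
      m (ℕ.≤-trans (s≤s z≤n) 2≤m) ℕ.≤-refl (subst (b ~_) (sym fm≡s₂) b~s₂)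

module Diamond {n : ℕ} (G : Graph n) (no-wheel : ¬ ContainsWheel G) {a b c d : Fin n}
  (a≢c : a ≢ c) (a≢d : a ≢ d) (b≢c : b ≢ c) (b≢d : b ≢ d) (c≢d : c ≢ d)
  (a~b : Adj G a b) (a~c : Adj G a c) (a~d : Adj G a d) (b~c : Adj G b c) (b~d : Adj G b d)
  (c≁d : ¬ Adj G c d) where

  open Properties G

  CommonNeighbour : Fin n → Set
  CommonNeighbour v = a ~ v × b ~ v

  InS₀ : Fin n → Set
  InS₀ v = v ≡ a ⊎ v ≡ b ⊎ (CommonNeighbour v × v ≢ c × v ≢ d)

  inS₀? : ∀ v → Dec (InS₀ v)
  inS₀? v = (v ≟ a) ⊎-dec (v ≟ b) ⊎-dec ((a ~? v ×-dec b ~? v) ×-dec ¬? (v ≟ c) ×-dec ¬? (v ≟ d))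

  S₀ : Subset n
  S₀ = toSubset inS₀?

  c∉S₀ : c ∉ S₀
  c∉S₀ c∈ with ∈-toSubset⁻ inS₀? c∈
  ... | inj₁ c≡a = a≢c (sym c≡a)
  ... | inj₂ (inj₁ c≡b) = b≢c (sym c≡b)
  ... | inj₂ (inj₂ (_ , c≢c , _)) = c≢c refl

  d∉S₀ : d ∉ S₀
  d∉S₀ d∈ with ∈-toSubset⁻ inS₀? d∈
  ... | inj₁ d≡a = a≢d (sym d≡a)
  ... | inj₂ (inj₁ d≡b) = b≢d (sym d≡b)
  ... | inj₂ (inj₂ (_ , _ , d≢d)) = d≢d refl

  S₀-separates : ¬ Reach G S₀ c d
  S₀-separates r with induced-path r
  ... | path m f P f₀≡d fm≡c avoids
    with common-interior-neighbour P (length≥2 P f₀≡d fm≡c c≢d c≁d) a~b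
           (λ k k≤ eq → avoids k k≤ (∈-toSubset⁺ inS₀? (inj₁ eq)))
           (λ k k≤ eq → avoids k k≤ (∈-toSubset⁺ inS₀? (inj₂ (inj₁ eq))))
           (subst (a ~_) (sym f₀≡d) a~d) (subst (b ~_) (sym f₀≡d) b~d)
           (subst (a ~_) (sym fm≡c) a~c) (subst (b ~_) (sym fm≡c) b~c)
  ... | inj₁ wheel = no-wheel wheel
  ... | inj₂ (j , 1≤j , j<m , a~fj , b~fj) =
    avoids j (ℕ.<⇒≤ j<m) (∈-toSubset⁺ inS₀? (inj₂ (inj₂ ((a~fj , b~fj) , fj≢c , fj≢d))))
    where
    fj≢c : f j ≢ c
    fj≢c eq = ℕ.<⇒≢ j<m (injective P (ℕ.<⇒≤ j<m) ℕ.≤-refl (trans eq (sym fm≡c)))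
    fj≢d : f j ≢ d
    fj≢d eq = ℕ.n>0⇒n≢0 1≤j (injective P (ℕ.<⇒≤ j<m) z≤n (trans eq (sym f₀≡d)))

  S₁ S₂ : Subset n
  S₁ = refine S₀ c
  S₂ = refine S₁ d

  S₂⊆S₀ : ∀ {v} → v ∈ S₂ → v ∈ S₀
  S₂⊆S₀ v∈ = refine-⊆ (refine-⊆ v∈)

  d∉S₁ : d ∉ S₁
  d∉S₁ d∈ = d∉S₀ (refine-⊆ d∈)

  S₂-separates : ¬ Reach G S₂ c d
  S₂-separates r =
    refine-separates d∉S₁ (λ r′ → refine-separates c∉S₀ S₀-separates (reach-sym r′)) (reach-sym r)

  attached-to-c : ∀ {s} → s ∈ S₂ → Attached S₂ c s
  attached-to-c s∈ = attached-weaken (λ v v∉ v∈ → v∉ (S₂⊆S₀ v∈)) (refine-attached (refine-⊆ s∈))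

  attached-to-d : ∀ {s} → s ∈ S₂ → Attached S₂ d s
  attached-to-d s∈ = attached-weaken (λ v v∉ v∈ → v∉ (refine-⊆ v∈)) (refine-attached s∈)

  a∈S₂ : a ∈ S₂
  a∈S₂ = ∈-refine⁺ (∈-refine⁺ (∈-toSubset⁺ inS₀? (inj₁ refl)) (c , a~c , here c∉S₀)) (d , a~d , here d∉S₁)

  b∈S₂ : b ∈ S₂
  b∈S₂ = ∈-refine⁺ (∈-refine⁺ (∈-toSubset⁺ inS₀? (inj₂ (inj₁ refl))) (c , b~c , here c∉S₀)) (d , b~d , here d∉S₁)

  S₂-adjacent : ∀ {x y} → InS₀ x → InS₀ y → x ∈ S₂ → y ∈ S₂ → x ≢ y → x ~ y
  S₂-adjacent (inj₁ refl) (inj₁ refl) _ _ x≢y = ⊥-elim (x≢y refl)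
  S₂-adjacent (inj₁ refl) (inj₂ (inj₁ refl)) _ _ _ = a~b
  S₂-adjacent (inj₁ refl) (inj₂ (inj₂ ((a~y , _) , _))) _ _ _ = a~y
  S₂-adjacent (inj₂ (inj₁ refl)) (inj₁ refl) _ _ _ = ~-sym a~b
  S₂-adjacent (inj₂ (inj₁ refl)) (inj₂ (inj₁ refl)) _ _ x≢y = ⊥-elim (x≢y refl)
  S₂-adjacent (inj₂ (inj₁ refl)) (inj₂ (inj₂ ((_ , b~y) , _))) _ _ _ = b~y
  S₂-adjacent (inj₂ (inj₂ ((a~x , _) , _))) (inj₁ refl) _ _ _ = ~-sym a~x
  S₂-adjacent (inj₂ (inj₂ ((_ , b~x) , _))) (inj₂ (inj₁ refl)) _ _ _ = ~-sym b~x
  S₂-adjacent {x} {y} (inj₂ (inj₂ ((a~x , b~x) , _))) (inj₂ (inj₂ ((a~y , b~y) , _))) x∈ y∈ x≢y =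
    decidable-stable (x ~? y) λ x≁y →
      no-wheel (nonadjacent-pair-wheel S₂-separates x≢y x≁y
                  (attached-to-c x∈) (attached-to-c y∈)
                  (attached-to-d x∈) (attached-to-d y∈)
                  a∈S₂ b∈S₂ a~b a~x a~y b~x b~y)

  S₂-clique : IsClique G S₂
  S₂-clique x y x∈ y∈ =
    S₂-adjacent (∈-toSubset⁻ inS₀? (S₂⊆S₀ x∈)) (∈-toSubset⁻ inS₀? (S₂⊆S₀ y∈)) x∈ y∈

  clique-cutset : HasCliqueCutset G
  clique-cutset = S₂ , S₂-clique , c , d , (λ c∈ → c∉S₀ (S₂⊆S₀ c∈)) , (λ d∈ → d∉S₁ (refine-⊆ d∈)) , S₂-separates

lemma3p2 : ∀ {n} (G : Graph n) → ¬ ContainsWheel G → ContainsDiamond G → HasCliqueCutset G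
lemma3p2 G no-wheel (a , b , c , d , _ , a≢c , a≢d , b≢c , b≢d , c≢d , a~b , a~c , a~d , b~c , b~d , c≁d) =
  Diamond.clique-cutset G no-wheel a≢c a≢d b≢c b≢d c≢d a~b a~c a~d b~c b~d c≁d
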